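{- Let $d\ge 2$, $n\ge 1$ and let $w\in\mathcal A_d^n$ be $\ell_1$-periodic or almost $\ell_1$-periodic. Let $m\in\{1,\dots,d-1\}$ and $k\in\{1,\dots,n\}$ with $k\le n-\ell_1$ or $k>\ell_1$. Then for every positive integer $\ell_2<\frac n2$ with $\ell_1\ge\ell_2$ and $n\ge\ell_1+\ell_2$, the string $w^{(k,m)}$ is not $\ell_2$-periodic.
   Context: $\mathcal A_d=\{0,1,\dots,d-1\}$; $\mathcal A_d^n$ is the set of strings $w=w_1\cdots w_n$ over $\mathcal A_d$. For a position $k$ and $m\in\mathcal A_d$, $w^{(k,m)}$ is obtained from $w$ by replacing $w_k$ by $(w_k+m)\bmod d$ and keeping all other letters. A string $w$ of length $L$ has period length $\ell$ (a positive integer) if $L\ge 2\ell$ and $w_i=w_{i+\ell}$ for all $1\le i\le L-\ell$; $w$ is $\ell$-periodic if it has period length $\ell$ and no period length $k'<\ell$. A string $w$ of length $L$ is almost $\ell$-periodic if $\ell>L/2$ and there is a string $w'$ of length $2\ell-L$ such that the concatenation $w\oplus w'$ is $\ell$-periodic. -}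

module Defs where

open import Data.Nat using (ℕ; zero; suc; _+_; _*_; _∸_; _≤_; _<_; NonZero)
open import Data.Nat.DivMod using (_mod_)
open import Data.Fin using (Fin; toℕ; _≟_)
open import Data.Vec.Functional using (Vector; _++_)
open import Data.Product using (Σ; _×_; _,_)
open import Relation.Binary.PropositionalEquality using (_≡_)
open import Relation.Nullary using (¬_)

-- A string of length L over the alphabet A_d = {0,…,d-1}.
-- Positions are 0-indexed: position (i : Fin L) is the letter w_{i+1} of the paper.
Str : ℕ → ℕ → Set
Str d L = Vector (Fin d) L

HasPeriod : ∀ {d L} → Str d L → ℕ → Set
HasPeriod {d} {L} w ℓ =
  (1 ≤ ℓ) × (2 * ℓ ≤ L) ×
  ((i j : Fin L) → toℕ j ≡ toℕ i + ℓ → w i ≡ w j)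

IsPeriodic : ∀ {d L} → Str d L → ℕ → Set
IsPeriodic w ℓ = HasPeriod w ℓ × ((k : ℕ) → 1 ≤ k → k < ℓ → ¬ HasPeriod w k)

IsAlmostPeriodic : ∀ {d L} → Str d L → ℕ → Set
IsAlmostPeriodic {d} {L} w ℓ =
  (L < 2 * ℓ) × Σ (Str d (2 * ℓ ∸ L)) (λ w' → IsPeriodic (w ++ w') ℓ)

update : ∀ {d L} .{{_ : NonZero d}} → Str d L → Fin L → ℕ → Str d L
update {d} w k m i with i ≟ k
... | Relation.Nullary.yes _ = (toℕ (w i) + m) mod d
... | Relation.Nullary.no _ = w i

module Submission where

-- Write p = ℓ₂, q = ℓ₁.  As v has period p, v i depends only on i mod p; call
-- this value U (i mod p).  If a residue r has a representative i with
-- i, i + q < n and k ∉ {i, i + q}, then U r = U (r + q), since v = w there and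
-- w has period q.  This holds for all residues but that of e = k (if
-- k + q < n) or e = k - q (if q ≤ k).  The orbit of e + q under r ↦ r + q
-- returns to e's residue, so U (e + q) = U e; this forces v k = w k,
-- although the letter at k was changed.

open import Defs
open import Data.Nat using (ℕ; suc; _+_; _*_; _∸_; _≤_; _<_; _>_)
open import Data.Fin using (Fin; toℕ)
open import Data.Sum using (_⊎_)
open import Relation.Nullary using (¬_)

open import Data.Nat using (zero; s≤s; s≤s⁻¹; NonZero; >-nonZero; >-nonZero⁻¹; _<?_; _/_; _%_)
import Data.Nat.Properties as ℕ
open import Data.Nat.DivMod
  using (_mod_; m≡m%n+[m/n]*n; m%n%n≡m%n; [m+n]%n≡m%n; [m+kn]%n≡m%n;
         %-distribˡ-+; m%n<n; m<n⇒m%n≡m; m≤n⇒[n∸m]%m≡n%m)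
import Data.Fin as Fin
import Data.Fin.Properties as Fin
open import Data.Vec.Functional using (_++_)
open import Data.Vec.Functional.Properties using (lookup-++ˡ)
open import Data.Product using (_,_)
open import Data.Sum using (inj₁; inj₂)
open import Data.Empty using (⊥-elim)
open import Function using (_∘_)
open import Relation.Nullary using (yes; no)
open import Relation.Binary.PropositionalEquality
open ≡-Reasoning

PeriodicBelow : {A : Set} → ℕ → ℕ → (ℕ → A) → Set
PeriodicBelow n p f = ∀ i → i + p < n → f i ≡ f (i + p)

periodic-mod : ∀ {A : Set} {n} p .{{_ : NonZero p}} {f : ℕ → A} →
  PeriodicBelow n p f → ∀ i → i < n → f i ≡ f (i % p)
periodic-mod {n = n} p {f} per i i<n =
  trans (cong f split) (shift-back (i / p) (i % p) (subst (_< n) split i<n))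
  where
    split : i ≡ i % p + (i / p) * p
    split = m≡m%n+[m/n]*n i p

    shift-back : ∀ c r → r + c * p < n → f (r + c * p) ≡ f r
    shift-back zero    r _  = cong f (ℕ.+-identityʳ r)
    shift-back (suc c) r lt = begin
      f (r + (p + c * p)) ≡⟨ cong f reassoc ⟩
      f (r + c * p + p)   ≡⟨ per (r + c * p) (subst (_< n) reassoc lt) ⟨
      f (r + c * p)       ≡⟨ shift-back c r (ℕ.<-trans (ℕ.m<m+n _ (>-nonZero⁻¹ p)) (subst (_< n) reassoc lt)) ⟩
      f r                 ∎
      where
        reassoc : r + (p + c * p) ≡ r + c * p + p
        reassoc = trans (cong (r +_) (ℕ.+-comm p (c * p))) (sym (ℕ.+-assoc r (c * p) p))

%-shift : ∀ p .{{_ : NonZero p}} a b c → a % p ≡ b % p → (a + c) % p ≡ (b + c) % p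
%-shift p a b c a≡b = begin
  (a + c) % p             ≡⟨ %-distribˡ-+ a c p ⟩
  (a % p + c % p) % p     ≡⟨ cong (λ r → (r + c % p) % p) a≡b ⟩
  (b % p + c % p) % p     ≡⟨ %-distribˡ-+ b c p ⟨
  (b + c) % p             ∎

-- Orbit argument: if U depends only on residues mod p and the step x ↦ x + q
-- preserves U at every residue other than that of e, then it also preserves U
-- at e, because the orbit of e + q under the step returns to e's residue.
orbit-closes : ∀ {A : Set} p .{{_ : NonZero p}} q e (U : ℕ → A) →
  (∀ x y → x % p ≡ y % p → U x ≡ U y) →
  (∀ x → x % p ≢ e % p → U x ≡ U (x + q)) →
  U (e + q) ≡ U e
orbit-closes (suc p') q e U U-resp step with walk p'
  where
    walk : ∀ j → U (e + q) ≡ U e ⊎ U (e + q) ≡ U (e + suc j * q)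
    walk zero = inj₂ (cong (λ t → U (e + t)) (sym (ℕ.+-identityʳ q)))
    walk (suc j) with walk j
    ... | inj₁ closed = inj₁ closed
    ... | inj₂ same with (e + suc j * q) % suc p' ℕ.≟ e % suc p'
    ...   | yes back = inj₁ (trans same (U-resp _ _ back))
    ...   | no away  = inj₂ (trans same (trans (step _ away) (cong U next)))
      where
        next : e + suc j * q + q ≡ e + suc (suc j) * q
        next = trans (ℕ.+-assoc e (suc j * q) q) (cong (e +_) (ℕ.+-comm (suc j * q) q))
... | inj₁ closed = closed
... | inj₂ same   = trans same (U-resp _ _ full-turn)
  where
    full-turn : (e + suc p' * q) % suc p' ≡ e % suc p'
    full-turn = trans (cong (λ t → (e + t) % suc p') (ℕ.*-comm (suc p') q)) ([m+kn]%n≡m%n e q (suc p'))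

module SingleDefect {A : Set} {n p q k : ℕ} .{{_ : NonZero p}} {f g : ℕ → A}
  (f-per : PeriodicBelow n p f) (g-per : PeriodicBelow n q g)
  (agree : ∀ i → i < n → i ≢ k → f i ≡ g i)
  (p≤q : p ≤ q) (p+q≤n : p + q ≤ n) where

  U : ℕ → A
  U x = f (x % p)

  U-resp : ∀ x y → x % p ≡ y % p → U x ≡ U y
  U-resp x y = cong f

  f≡U : ∀ i → i < n → f i ≡ U i
  f≡U = periodic-mod p f-per

  q>0 : q > 0
  q>0 = ℕ.<-≤-trans (>-nonZero⁻¹ p) p≤q

  +q≢ : ∀ a → a + q ≢ a
  +q≢ a = ℕ.<⇒≢ (ℕ.m<m+n a q>0) ∘ sym

  step-via : ∀ x i → i % p ≡ x % p → i + q < n → i ≢ k → i + q ≢ k → U x ≡ U (x + q)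
  step-via x i i≡x iq<n i≢k iq≢k = begin
    U x       ≡⟨ U-resp x i (sym i≡x) ⟩
    U i       ≡⟨ f≡U i i<n ⟨
    f i       ≡⟨ agree i i<n i≢k ⟩
    g i       ≡⟨ g-per i iq<n ⟩
    g (i + q) ≡⟨ agree (i + q) iq<n iq≢k ⟨
    f (i + q) ≡⟨ f≡U (i + q) iq<n ⟩
    U (i + q) ≡⟨ U-resp (i + q) (x + q) (%-shift p i x q i≡x) ⟩
    U (x + q) ∎
    where i<n = ℕ.≤-trans (ℕ.m≤m+n (suc i) q) iq<n

  off-class : ∀ i j → i % p ≢ j % p → i ≢ j
  off-class i j ne = ne ∘ cong (_% p)

  least+q<n : ∀ x → x % p + q < n
  least+q<n x = ℕ.<-≤-trans (ℕ.+-monoˡ-< q (m%n<n x p)) p+q≤n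

  defect-right : k + q < n → f k ≡ g k
  defect-right kq<n = begin
    f k       ≡⟨ f≡U k k<n ⟩
    U k       ≡⟨ orbit-closes p q k U U-resp step ⟨
    U (k + q) ≡⟨ f≡U (k + q) kq<n ⟨
    f (k + q) ≡⟨ agree (k + q) kq<n (+q≢ k) ⟩
    g (k + q) ≡⟨ g-per k kq<n ⟨
    g k       ∎
    where
      k<n = ℕ.≤-trans (ℕ.m≤m+n (suc k) q) kq<n

      -- Use x % p, or x % p + p if x % p + q happens to hit k.
      step : ∀ x → x % p ≢ k % p → U x ≡ U (x + q)
      step x x≢k with x % p + q ℕ.≟ k
      ... | no  hit = step-via x (x % p) (m%n%n≡m%n x p) (least+q<n x)
                        (off-class _ _ (x≢k ∘ trans (sym (m%n%n≡m%n x p)))) hit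
      ... | yes hit = step-via x i i≡x iq<n (off-class _ _ (x≢k ∘ trans (sym i≡x)))
                        (ℕ.<⇒≢ (ℕ.m<m+n k (>-nonZero⁻¹ p)) ∘ sym ∘ trans (sym iq≡kp))
        where
          i = x % p + p
          i≡x : i % p ≡ x % p
          i≡x = trans ([m+n]%n≡m%n (x % p) p) (m%n%n≡m%n x p)
          iq≡kp : i + q ≡ k + p
          iq≡kp = begin
            x % p + p + q   ≡⟨ ℕ.+-assoc (x % p) p q ⟩
            x % p + (p + q) ≡⟨ cong (x % p +_) (ℕ.+-comm p q) ⟩
            x % p + (q + p) ≡⟨ ℕ.+-assoc (x % p) q p ⟨
            x % p + q + p   ≡⟨ cong (_+ p) hit ⟩
            k + p           ∎
          iq<n : i + q < n
          iq<n = subst (_< n) (sym iq≡kp) (ℕ.<-≤-trans (ℕ.+-monoʳ-≤ (suc k) p≤q) kq<n)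

  defect-left : q ≤ k → k < n → f k ≡ g k
  defect-left q≤k k<n = begin
    f k       ≡⟨ f≡U k k<n ⟩
    U k       ≡⟨ cong U e+q≡k ⟨
    U (e + q) ≡⟨ orbit-closes p q e U U-resp step ⟩
    U e       ≡⟨ f≡U e e<n ⟨
    f e       ≡⟨ agree e e<n (λ e≡k → +q≢ e (trans e+q≡k (sym e≡k))) ⟩
    g e       ≡⟨ g-per e (subst (_< n) (sym e+q≡k) k<n) ⟩
    g (e + q) ≡⟨ cong g e+q≡k ⟩
    g k       ∎
    where
      e = k ∸ q
      e+q≡k : e + q ≡ k
      e+q≡k = ℕ.m∸n+n≡m q≤k
      e<n : e < n
      e<n = ℕ.≤-<-trans (ℕ.m∸n≤m k q) k<n

      -- Here x % p < p ≤ q ≤ k, and x % p + q = k would put x in e's class.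
      step : ∀ x → x % p ≢ e % p → U x ≡ U (x + q)
      step x x≢e = step-via x (x % p) (m%n%n≡m%n x p) (least+q<n x)
        (ℕ.<⇒≢ (ℕ.<-≤-trans (m%n<n x p) (ℕ.≤-trans p≤q q≤k)))
        (λ hit → x≢e (trans (sym (m%n%n≡m%n x p)) (cong (_% p) (begin
          x % p         ≡⟨ ℕ.m+n∸n≡m (x % p) q ⟨
          x % p + q ∸ q ≡⟨ cong (_∸ q) hit ⟩
          e             ∎))))

  single-defect : k + q < n ⊎ q ≤ k → k < n → f k ≡ g k
  single-defect (inj₁ kq<n) _   = defect-right kq<n
  single-defect (inj₂ q≤k)  k<n = defect-left q≤k k<n

open SingleDefect using (single-defect)

PeriodOnFin : ∀ {A : Set} {L} → (Fin L → A) → ℕ → Set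
PeriodOnFin {L = L} h ℓ = (i j : Fin L) → toℕ j ≡ toℕ i + ℓ → h i ≡ h j

period-condition : ∀ {d L} (w : Str d L) ℓ →
  IsPeriodic w ℓ ⊎ IsAlmostPeriodic w ℓ → PeriodOnFin w ℓ
period-condition w ℓ (inj₁ ((_ , _ , period) , _)) = period
period-condition {L = L} w ℓ (inj₂ (_ , w' , ((_ , _ , period) , _))) i j j≡i+ℓ = begin
  w i                      ≡⟨ lookup-++ˡ w w' i ⟨
  (w ++ w') (i Fin.↑ˡ r)   ≡⟨ period (i Fin.↑ˡ r) (j Fin.↑ˡ r) shifted ⟩
  (w ++ w') (j Fin.↑ˡ r)   ≡⟨ lookup-++ˡ w w' j ⟩
  w j                      ∎
  where
    r = 2 * ℓ ∸ L
    shifted : toℕ (j Fin.↑ˡ r) ≡ toℕ (i Fin.↑ˡ r) + ℓ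
    shifted = begin
      toℕ (j Fin.↑ˡ r)     ≡⟨ Fin.toℕ-↑ˡ j r ⟩
      toℕ j                ≡⟨ j≡i+ℓ ⟩
      toℕ i + ℓ            ≡⟨ cong (_+ ℓ) (Fin.toℕ-↑ˡ i r) ⟨
      toℕ (i Fin.↑ˡ r) + ℓ ∎

extend : ∀ {A : Set} {L} → A → (Fin L → A) → ℕ → A
extend {L = L} a h i with i <? L
... | yes i<L = h (Fin.fromℕ< i<L)
... | no  _   = a

extend-< : ∀ {A : Set} {L} (a : A) (h : Fin L → A) i (i<L : i < L) →
  extend a h i ≡ h (Fin.fromℕ< i<L)
extend-< {L = L} a h i i<L with i <? L
... | yes _  = refl
... | no i≮L = ⊥-elim (i≮L i<L)

extend-toℕ : ∀ {A : Set} {L} (a : A) (h : Fin L → A) (i : Fin L) → extend a h (toℕ i) ≡ h i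
extend-toℕ a h i = trans (extend-< a h (toℕ i) (Fin.toℕ<n i)) (cong h (Fin.fromℕ<-toℕ i _))

extend-periodic : ∀ {A : Set} {L} (a : A) (h : Fin L → A) ℓ →
  PeriodOnFin h ℓ → PeriodicBelow L ℓ (extend a h)
extend-periodic {L = L} a h ℓ period i i+ℓ<L = begin
  extend a h i       ≡⟨ extend-< a h i i<L ⟩
  h (Fin.fromℕ< i<L) ≡⟨ period _ _ positions ⟩
  h (Fin.fromℕ< i+ℓ<L) ≡⟨ extend-< a h (i + ℓ) i+ℓ<L ⟨
  extend a h (i + ℓ) ∎
  where
    i<L = ℕ.≤-trans (ℕ.m≤m+n (suc i) ℓ) i+ℓ<L
    positions : toℕ (Fin.fromℕ< i+ℓ<L) ≡ toℕ (Fin.fromℕ< i<L) + ℓ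
    positions = trans (Fin.toℕ-fromℕ< i+ℓ<L) (cong (_+ ℓ) (sym (Fin.toℕ-fromℕ< i<L)))

extend-update : ∀ {d L} .{{_ : NonZero d}} (a : Fin d) (w : Str d L) k m i →
  i ≢ toℕ k → extend a (update w k m) i ≡ extend a w i
extend-update {L = L} a w k m i i≢k with i <? L
... | no  _   = refl
... | yes i<L with Fin.fromℕ< i<L Fin.≟ k
...   | yes at-k = ⊥-elim (i≢k (trans (sym (Fin.toℕ-fromℕ< i<L)) (cong toℕ at-k)))
...   | no  _    = refl

update-at : ∀ {d L} .{{_ : NonZero d}} (w : Str d L) k m → update w k m k ≡ (toℕ (w k) + m) mod d
update-at w k m with k Fin.≟ k
... | yes _  = refl
... | no k≢k = ⊥-elim (k≢k refl)

shift-changes-letter : ∀ D .{{_ : NonZero D}} (a : Fin D) m → 0 < m → m < D → (toℕ a + m) mod D ≢ a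
shift-changes-letter D a m m>0 m<D same =
  moved (trans (sym (Fin.toℕ-fromℕ< (m%n<n (toℕ a + m) D))) (cong toℕ same))
  where
    x = toℕ a
    moved : (x + m) % D ≢ x
    moved with x + m <? D
    ... | yes fits = ℕ.<⇒≢ (ℕ.m<m+n x m>0) ∘ sym ∘ trans (sym (m<n⇒m%n≡m fits))
    ... | no  wraps = ℕ.<⇒≢ r<x ∘ trans (sym r≡)
      where
        D≤x+m = ℕ.≮⇒≥ wraps
        r = x + m ∸ D
        r<x : r < x
        r<x = subst (r <_) (ℕ.m+n∸n≡m x D) (ℕ.∸-monoˡ-< (ℕ.+-monoʳ-< x m<D) D≤x+m)
        r≡ : (x + m) % D ≡ r
        r≡ = trans (sym (m≤n⇒[n∸m]%m≡n%m D≤x+m)) (m<n⇒m%n≡m (ℕ.<-trans r<x (Fin.toℕ<n a)))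

-- The paper's hypothesis "k ≤ n - ℓ₁ or k > ℓ₁" (1-indexed) says that k has a
-- partner k + ℓ₁ or k - ℓ₁ inside the string.
partner-in-range : ∀ n ℓ k → ℓ ≤ n → suc k ≤ n ∸ ℓ ⊎ suc k > ℓ → k + ℓ < n ⊎ ℓ ≤ k
partner-in-range n ℓ k ℓ≤n (inj₁ right) =
  inj₁ (subst (suc (k + ℓ) ≤_) (ℕ.m∸n+n≡m ℓ≤n) (ℕ.+-monoˡ-≤ ℓ right))
partner-in-range n ℓ k ℓ≤n (inj₂ left) = inj₂ (s≤s⁻¹ left)

lemma2p15 : (d' n ℓ₁ ℓ₂ m : ℕ) → 1 ≤ n → (w : Str (suc (suc d')) n) →
    (IsPeriodic w ℓ₁ ⊎ IsAlmostPeriodic w ℓ₁) →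
    1 ≤ m → m ≤ suc d' →
    (k : Fin n) → (suc (toℕ k) ≤ n ∸ ℓ₁ ⊎ suc (toℕ k) > ℓ₁) →
    1 ≤ ℓ₂ → 2 * ℓ₂ < n → ℓ₂ ≤ ℓ₁ → ℓ₁ + ℓ₂ ≤ n →
    ¬ IsPeriodic (update w k m) ℓ₂
lemma2p15 d' n ℓ₁ ℓ₂ m _ w w-almost m>0 m≤d' k k-partner ℓ₂>0 _ ℓ₂≤ℓ₁ ℓ₁+ℓ₂≤n ((_ , _ , v-period) , _) =
  shift-changes-letter D (w k) m m>0 (s≤s m≤d') (begin
    (toℕ (w k) + m) mod D   ≡⟨ update-at w k m ⟨
    v k                     ≡⟨ extend-toℕ Fin.zero v k ⟨
    extend Fin.zero v (toℕ k) ≡⟨ single-defect v-per w-per agree ℓ₂≤ℓ₁ ℓ₂+ℓ₁≤n partner (Fin.toℕ<n k) ⟩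
    extend Fin.zero w (toℕ k) ≡⟨ extend-toℕ Fin.zero w k ⟩
    w k                     ∎)
  where
    D = suc (suc d')
    v = update w k m
    instance
      ℓ₂-nonZero : NonZero ℓ₂
      ℓ₂-nonZero = >-nonZero ℓ₂>0
    v-per = extend-periodic Fin.zero v ℓ₂ v-period
    w-per = extend-periodic Fin.zero w ℓ₁ (period-condition w ℓ₁ w-almost)
    agree : ∀ i → i < n → i ≢ toℕ k → extend Fin.zero v i ≡ extend Fin.zero w i
    agree i _ = extend-update Fin.zero w k m i
    ℓ₂+ℓ₁≤n = subst (_≤ n) (ℕ.+-comm ℓ₁ ℓ₂) ℓ₁+ℓ₂≤n
    partner = partner-in-range n ℓ₁ (toℕ k) (ℕ.≤-trans (ℕ.m≤m+n ℓ₁ ℓ₂) ℓ₁+ℓ₂≤n) k-partner
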